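{- Let $n,s$ be positive integers and put $$N(n,s)=\sum_{m=1}^{n}\sum_{q=1}^{\min(m,s)}\binom{s}{q}\left\{\binom{ -1+\frac{m}{2}}{q-1}'+\sum_{(n_1,\ldots,n_q)\in\Omega_q(m)}\left\lfloor \frac12\prod_{j=1}^{q}(n_j+1)\right\rfloor\right\}.$$ Then $$N(n,s)=T(n,2s)+T\!\left(\left\lfloor \tfrac n2\right\rfloor,s\right),\qquad\text{where } T(n,p)=-\frac12+\frac12\binom{n+p}{p}.$$
   Context: For real $p$ and integer $q$, $\binom{p}{q}'$ denotes $\binom{p}{q}$ if $p$ and $q$ are nonnegative integers, and $0$ otherwise. $\Omega_q(m)$ is the set of ordered $q$-tuples $(n_1,\ldots,n_q)$ of positive integers with $n_1+\cdots+n_q=m$. $\lfloor x\rfloor$ is the integer part. (Motivation: for a local ring $R$ with $2\in R^*$, $|R^*:R^{*2}|=2$, maximal ideal nilpotent of step $s$ and $(1+R^{*2})\subset R^{*2}$, this sum is known to count the classes of projectively congruent quadrics of $RP_{n-1}$; the theorem is the identity above.) -}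

module Defs where

open import Data.Nat using (ℕ; zero; suc; _+_; _*_; _∸_; _/_; _⊓_)
open import Data.Nat.Combinatorics using (_C_)
open import Data.Integer using (ℤ; +_; -[1+_]) renaming (_-_ to _-ℤ_)
open import Data.List using (List; []; _∷_; map; concatMap; upTo)
open import Data.Nat.ListAction using (sum; product)
open import Data.Bool using (if_then_else_)
open import Data.Nat using (_%_; _≡ᵇ_)
import Data.Rational as ℚ
open ℚ using (ℚ; ½; -½)

-- Σ_{i=a}^{b} f i  (inclusive; empty if b < a)
Σ[_⋯_] : ℕ → ℕ → (ℕ → ℕ) → ℕ
Σ[ a ⋯ b ] f = sum (map (λ i → f (a + i)) (upTo (suc b ∸ a)))

-- Primed binomial coefficient binom(p,k)' for p = a/2 a half-integer
-- (a : ℤ) and k : ℤ:  equals binom(p,k) when p and k are nonnegative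
-- integers, and 0 otherwise.
binom′½ : ℤ → ℤ → ℕ
binom′½ (+ a) (+ k) = if (a % 2 ≡ᵇ 0) then (a / 2) C k else 0
binom′½ (+ a) -[1+ k ] = 0
binom′½ -[1+ a ] k = 0

-- Ω q m : the list of all ordered q-tuples (n₁,…,n_q) of positive
-- integers with n₁+⋯+n_q = m (each tuple listed exactly once).
Ω : ℕ → ℕ → List (List ℕ)
Ω zero zero = [] ∷ []
Ω zero (suc m) = []
Ω (suc q) m = concatMap (λ i → map (suc i ∷_) (Ω q (m ∸ suc i))) (upTo m)

N : ℕ → ℕ → ℕ
N n s = Σ[ 1 ⋯ n ] (λ m → Σ[ 1 ⋯ (m ⊓ s) ] (λ q →
          (s C q) * ( binom′½ (+ m -ℤ + 2) (+ q -ℤ + 1)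
                    + sum (map (λ t → product (map suc t) / 2) (Ω q m)))))

T : ℕ → ℕ → ℚ
T n p = -½ ℚ.+ ½ ℚ.* ((+ ((n + p) C p)) ℚ./ 1)

module Submission where

-- Proof by generating functions, phrased with finite convolutions of
-- sequences ℕ → ℕ.
--
-- For a weight w : ℕ → ℕ, let ΣΩ w q m be the sum over the compositions
-- (n₁,…,n_q) ∈ Ω q m of w n₁ ⋯ w n_q.  Then ΣΩ w q is the q-th
-- convolution power of the positive part of w, so the binomial sum
-- Σ_q C(s,q) ΣΩ w q is the s-th convolution power of w when w 0 = 1, and
-- its partial sums are the s-th power convolved with the all-ones
-- sequence.  Two weights matter:
--   * w n = n + 1   (series 1/(1-x)²): partial sums C(n+2s, 2s);
--   * w n = [n even] (series 1/(1-x²)): partial sums C(⌊n/2⌋+s, s).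
-- On the other side, (n₁+1)⋯(n_q+1) has the parity of [n₁ even]⋯[n_q even],
-- so twice the floor term of N equals ΣΩ (suc) − ΣΩ (evenness), while the
-- primed half-integer binomial coefficient equals ΣΩ (evenness).  Hence
-- 2·N(n,s) + 2 = C(n+2s, 2s) + C(⌊n/2⌋+s, s), which is the theorem after
-- dividing by 2 in ℚ.

open import Defs
open import Function using (_∘_; const)
open import Data.Nat
open import Data.Nat.Properties
open import Algebra.Properties.CommutativeSemigroup +-commutativeSemigroup using (interchange)
open import Data.Nat.DivMod using (m≡m%n+[m/n]*n; [m+kn]%n≡m%n; m/n≡1+[m∸n]/n)
open import Data.Nat.Combinatorics using (_C_; nCn≡1; nC1≡n; nCk+nC[k+1]≡[n+1]C[k+1]; k>n⇒nCk≡0)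
open import Data.Nat.ListAction using (sum; product)
open import Data.Nat.ListAction.Properties using (sum-++)
open import Data.List using (List; []; _∷_; _++_; map; concatMap; upTo; applyUpTo)
open import Data.List.Properties using (map-++; map-∘; map-cong)
open import Data.Bool using (Bool; true; false; if_then_else_)
open import Data.Integer using (+_) renaming (_-_ to _-ℤ_)
import Data.Integer as ℤ
import Data.Integer.Properties as ℤP
import Data.Nat.Coprimality as Coprime
open import Relation.Binary.PropositionalEquality
import Data.Rational as ℚ
open ℚ using (ℚ; mkℚ; ½; -½)
open import Data.Rational.Properties using (normalize-coprime)
import Data.Rational.Solver as ℚSolver
import Data.Nat.Solver

open ≡-Reasoning

ι : ℕ → ℚ
ι x = (+ x) ℚ./ 1

ι-as-mkℚ : ∀ x → ι x ≡ mkℚ (+ x) 0 (Coprime.sym (Coprime.1-coprimeTo x))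
ι-as-mkℚ x = normalize-coprime (Coprime.sym (Coprime.1-coprimeTo x))

ι-+ : ∀ x y → ι (x + y) ≡ ι x ℚ.+ ι y
ι-+ x y = trans (cong (ℚ._/ 1) numerator) (sym (cong₂ ℚ._+_ (ι-as-mkℚ x) (ι-as-mkℚ y)))
  where
  numerator : + (x + y) ≡ + x ℤ.* + 1 ℤ.+ + y ℤ.* + 1
  numerator = trans (ℤP.pos-+ x y) (sym (cong₂ ℤ._+_ (ℤP.*-identityʳ (+ x)) (ℤP.*-identityʳ (+ y))))

halve : ∀ (m a b : ℕ) → 2 * m + 2 ≡ a + b → ι m ≡ (-½ ℚ.+ ½ ℚ.* ι a) ℚ.+ (-½ ℚ.+ ½ ℚ.* ι b)
halve m a b 2m+2≡a+b = sym (begin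
    (-½ ℚ.+ ½ ℚ.* ι a) ℚ.+ (-½ ℚ.+ ½ ℚ.* ι b)
  ≡⟨ solve 2 (λ u v → (con -½ :+ con ½ :* u) :+ (con -½ :+ con ½ :* v) := con -½ :+ con -½ :+ con ½ :* (u :+ v)) refl (ι a) (ι b) ⟩
    -½ ℚ.+ -½ ℚ.+ ½ ℚ.* (ι a ℚ.+ ι b)
  ≡⟨ cong (λ x → -½ ℚ.+ -½ ℚ.+ ½ ℚ.* x) (trans (sym (ι-+ a b)) (trans (cong ι (sym 2m+2≡a+b)) ι-2m+2)) ⟩
    -½ ℚ.+ -½ ℚ.+ ½ ℚ.* (ι m ℚ.+ ι m ℚ.+ ℚ.1ℚ ℚ.+ ℚ.1ℚ)
  ≡⟨ solve 1 (λ u → con -½ :+ con -½ :+ con ½ :* (u :+ u :+ con ℚ.1ℚ :+ con ℚ.1ℚ) := u) refl (ι m) ⟩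
    ι m
  ∎)
  where
  open ℚSolver.+-*-Solver using (solve; _:+_; _:*_; _:=_; con)
  ι-2m+2 : ι (2 * m + 2) ≡ ι m ℚ.+ ι m ℚ.+ ℚ.1ℚ ℚ.+ ℚ.1ℚ
  ι-2m+2 = begin
      ι (2 * m + 2)                   ≡⟨ cong ι (trans (cong (λ x → m + x + 2) (+-identityʳ m)) (sym (+-assoc (m + m) 1 1))) ⟩
      ι (m + m + 1 + 1)               ≡⟨ ι-+ (m + m + 1) 1 ⟩
      ι (m + m + 1) ℚ.+ ι 1           ≡⟨ cong (ℚ._+ ι 1) (ι-+ (m + m) 1) ⟩
      ι (m + m) ℚ.+ ι 1 ℚ.+ ι 1       ≡⟨ cong (λ x → x ℚ.+ ι 1 ℚ.+ ι 1) (ι-+ m m) ⟩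
      ι m ℚ.+ ι m ℚ.+ ℚ.1ℚ ℚ.+ ℚ.1ℚ   ∎

open Data.Nat.Solver.+-*-Solver using (solve; _:+_; _:*_; _:=_; con)

Seq : Set
Seq = ℕ → ℕ

sumTo : ℕ → Seq → ℕ
sumTo zero    h = 0
sumTo (suc n) h = h 0 + sumTo n (h ∘ suc)

sumTo-cong : ∀ n {h g : Seq} → (∀ i → i < n → h i ≡ g i) → sumTo n h ≡ sumTo n g
sumTo-cong zero    eq = refl
sumTo-cong (suc n) eq = cong₂ _+_ (eq 0 z<s) (sumTo-cong n (λ i i<n → eq (suc i) (s<s i<n)))

sumTo-zero : ∀ n {h : Seq} → (∀ i → i < n → h i ≡ 0) → sumTo n h ≡ 0
sumTo-zero zero    eq = refl
sumTo-zero (suc n) eq = cong₂ _+_ (eq 0 z<s) (sumTo-zero n (λ i i<n → eq (suc i) (s<s i<n)))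

sumTo-+ : ∀ n (h g : Seq) → sumTo n (λ i → h i + g i) ≡ sumTo n h + sumTo n g
sumTo-+ zero    h g = refl
sumTo-+ (suc n) h g rewrite sumTo-+ n (h ∘ suc) (g ∘ suc) =
  interchange (h 0) (g 0) (sumTo n (h ∘ suc)) (sumTo n (g ∘ suc))

sumTo-* : ∀ n a (h : Seq) → sumTo n (λ i → a * h i) ≡ a * sumTo n h
sumTo-* zero    a h = sym (*-zeroʳ a)
sumTo-* (suc n) a h rewrite sumTo-* n a (h ∘ suc) = sym (*-distribˡ-+ a (h 0) _)

sumTo-snoc : ∀ n (h : Seq) → sumTo (suc n) h ≡ sumTo n h + h n
sumTo-snoc zero    h = +-comm (h 0) 0
sumTo-snoc (suc n) h rewrite sumTo-snoc n (h ∘ suc) = sym (+-assoc (h 0) _ _)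

sumTo-⊓ : ∀ m s (h : Seq) → (∀ j → m ≤ j → h j ≡ 0) → sumTo (m ⊓ s) h ≡ sumTo s h
sumTo-⊓ zero    s       h vanish = sym (sumTo-zero s (λ j _ → vanish j z≤n))
sumTo-⊓ (suc m) zero    h vanish = refl
sumTo-⊓ (suc m) (suc s) h vanish =
  cong (λ x → h 0 + x) (sumTo-⊓ m s (h ∘ suc) (λ j m≤j → vanish (suc j) (s≤s m≤j)))

sum-applyUpTo : ∀ n (h f : Seq) → sum (map h (applyUpTo f n)) ≡ sumTo n (h ∘ f)
sum-applyUpTo zero    h f = refl
sum-applyUpTo (suc n) h f = cong (λ x → h (f 0) + x) (sum-applyUpTo n h (f ∘ suc))

Σ-from-1 : ∀ b (f : Seq) → Σ[ 1 ⋯ b ] f ≡ sumTo b (f ∘ suc)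
Σ-from-1 b f = sum-applyUpTo b (f ∘ suc) (λ i → i)

sum-map-+ : ∀ {X : Set} (f g : X → ℕ) xs →
  sum (map (λ x → f x + g x) xs) ≡ sum (map f xs) + sum (map g xs)
sum-map-+ f g []       = refl
sum-map-+ f g (x ∷ xs) rewrite sum-map-+ f g xs =
  interchange (f x) (g x) (sum (map f xs)) (sum (map g xs))

sum-map-* : ∀ {X : Set} a (f : X → ℕ) xs → sum (map (λ x → a * f x) xs) ≡ a * sum (map f xs)
sum-map-* a f []       = sym (*-zeroʳ a)
sum-map-* a f (x ∷ xs) rewrite sum-map-* a f xs = sym (*-distribˡ-+ a (f x) _)

sum-concatMap : ∀ {X Y : Set} (F : Y → ℕ) (G : X → List Y) xs →
  sum (map F (concatMap G xs)) ≡ sum (map (λ x → sum (map F (G x))) xs)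
sum-concatMap F G []       = refl
sum-concatMap F G (x ∷ xs) = begin
    sum (map F (G x ++ concatMap G xs))
  ≡⟨ cong sum (map-++ F (G x) (concatMap G xs)) ⟩
    sum (map F (G x) ++ map F (concatMap G xs))
  ≡⟨ sum-++ (map F (G x)) _ ⟩
    sum (map F (G x)) + sum (map F (concatMap G xs))
  ≡⟨ cong (λ y → sum (map F (G x)) + y) (sum-concatMap F G xs) ⟩
    sum (map F (G x)) + sum (map (λ x → sum (map F (G x))) xs)
  ∎

infixl 7 _⋆_
_⋆_ : Seq → Seq → Seq
(f ⋆ g) zero    = f 0 * g 0
(f ⋆ g) (suc m) = f 0 * g (suc m) + ((f ∘ suc) ⋆ g) m

⋆-as-sum : ∀ (f g : Seq) m → (f ⋆ g) m ≡ sumTo (suc m) (λ i → f i * g (m ∸ i))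
⋆-as-sum f g zero    = sym (+-identityʳ _)
⋆-as-sum f g (suc m) = cong (λ x → f 0 * g (suc m) + x) (⋆-as-sum (f ∘ suc) g m)

⋆-cong : ∀ {f f′ g g′ : Seq} → f ≗ f′ → g ≗ g′ → f ⋆ g ≗ f′ ⋆ g′
⋆-cong f≗ g≗ zero    = cong₂ _*_ (f≗ 0) (g≗ 0)
⋆-cong f≗ g≗ (suc m) = cong₂ _+_ (cong₂ _*_ (f≗ 0) (g≗ (suc m))) (⋆-cong (f≗ ∘ suc) g≗ m)

⋆-congʳ : ∀ (f : Seq) {g g′ : Seq} → g ≗ g′ → f ⋆ g ≗ f ⋆ g′
⋆-congʳ f = ⋆-cong {f} (λ _ → refl)

⋆-sucʳ : ∀ (f g : Seq) m → (f ⋆ g) (suc m) ≡ (f ⋆ (g ∘ suc)) m + f (suc m) * g 0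
⋆-sucʳ f g zero    = refl
⋆-sucʳ f g (suc m) rewrite ⋆-sucʳ (f ∘ suc) g m = sym (+-assoc (f 0 * g (suc (suc m))) _ _)

⋆-comm : ∀ (f g : Seq) → f ⋆ g ≗ g ⋆ f
⋆-comm f g zero    = *-comm (f 0) (g 0)
⋆-comm f g (suc m) rewrite ⋆-sucʳ g f m | ⋆-comm (f ∘ suc) g m =
  trans (+-comm (f 0 * g (suc m)) _) (cong (λ x → (g ⋆ (f ∘ suc)) m + x) (*-comm (f 0) (g (suc m))))

⋆-linˡ : ∀ a (u v h : Seq) → (λ k → a * u k + v k) ⋆ h ≗ λ m → a * (u ⋆ h) m + (v ⋆ h) m
⋆-linˡ a u v h zero =
  solve 4 (λ a u v h → (a :* u :+ v) :* h := a :* (u :* h) :+ v :* h) refl a (u 0) (v 0) (h 0)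
⋆-linˡ a u v h (suc m) rewrite ⋆-linˡ a (u ∘ suc) (v ∘ suc) h m =
  solve 6 (λ a u v h x y → (a :* u :+ v) :* h :+ (a :* x :+ y) := a :* (u :* h :+ x) :+ (v :* h :+ y))
    refl a (u 0) (v 0) (h (suc m)) (((u ∘ suc) ⋆ h) m) (((v ∘ suc) ⋆ h) m)

⋆-linʳ : ∀ a (f u v : Seq) → f ⋆ (λ k → a * u k + v k) ≗ λ m → a * (f ⋆ u) m + (f ⋆ v) m
⋆-linʳ a f u v m = begin
    (f ⋆ (λ k → a * u k + v k)) m   ≡⟨ ⋆-comm f _ m ⟩
    ((λ k → a * u k + v k) ⋆ f) m   ≡⟨ ⋆-linˡ a u v f m ⟩
    a * (u ⋆ f) m + (v ⋆ f) m       ≡⟨ cong₂ (λ x y → a * x + y) (⋆-comm u f m) (⋆-comm v f m) ⟩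
    a * (f ⋆ u) m + (f ⋆ v) m       ∎

⋆-assoc : ∀ (f g h : Seq) → (f ⋆ g) ⋆ h ≗ f ⋆ (g ⋆ h)
⋆-assoc f g h zero    = *-assoc (f 0) (g 0) (h 0)
⋆-assoc f g h (suc m) rewrite ⋆-linˡ (f 0) (g ∘ suc) ((f ∘ suc) ⋆ g) h m | ⋆-assoc (f ∘ suc) g h m =
  solve 5 (λ f g h x y → f :* g :* h :+ (f :* x :+ y) := f :* (g :* h :+ x) :+ y) refl
    (f 0) (g 0) (h (suc m)) (((g ∘ suc) ⋆ h) m) (((f ∘ suc) ⋆ (g ⋆ h)) m)

⋆-zeroˡ : ∀ (f g : Seq) → f ≗ const 0 → f ⋆ g ≗ const 0
⋆-zeroˡ f g f≗0 zero    rewrite f≗0 0 = refl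
⋆-zeroˡ f g f≗0 (suc m) rewrite f≗0 0 = ⋆-zeroˡ (f ∘ suc) g (f≗0 ∘ suc) m

δ : Seq
δ zero    = 1
δ (suc _) = 0

δ-⋆ : ∀ (g : Seq) → δ ⋆ g ≗ g
δ-⋆ g zero    = +-identityʳ (g 0)
δ-⋆ g (suc m) rewrite ⋆-zeroˡ (δ ∘ suc) g (λ _ → refl) m = trans (+-identityʳ _) (+-identityʳ _)

⋆-sumTo : ∀ n (c : Seq) (f : Seq) (g : ℕ → Seq) →
  f ⋆ (λ k → sumTo n (λ q → c q * g q k)) ≗ λ m → sumTo n (λ q → c q * (f ⋆ g q) m)
⋆-sumTo zero    c f g m = trans (⋆-comm f _ m) (⋆-zeroˡ _ f (λ _ → refl) m)
⋆-sumTo (suc n) c f g m = trans (⋆-linʳ (c 0) f (g 0) _ m)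
  (cong (λ x → c 0 * (f ⋆ g 0) m + x) (⋆-sumTo n (c ∘ suc) f (g ∘ suc) m))

one : Seq
one _ = 1

one-⋆-suc : ∀ (g : Seq) n → (one ⋆ g) (suc n) ≡ g (suc n) + (one ⋆ g) n
one-⋆-suc g n = cong (_+ (one ⋆ g) n) (+-identityʳ (g (suc n)))

one-⋆-as-sum : ∀ (g : Seq) n → (one ⋆ g) n ≡ g 0 + sumTo n (g ∘ suc)
one-⋆-as-sum g zero    = refl
one-⋆-as-sum g (suc n) rewrite one-⋆-suc g n | one-⋆-as-sum g n | sumTo-snoc n (g ∘ suc) =
  solve 3 (λ a b c → a :+ (b :+ c) := b :+ (c :+ a)) refl (g (suc n)) (g 0) (sumTo n (g ∘ suc))

hockey : ∀ r (g : Seq) → (∀ k → g k ≡ (k + r) C r) → ∀ n → (one ⋆ g) n ≡ (n + suc r) C suc r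
hockey r g g≡ zero    = trans (+-identityʳ (g 0)) (trans (g≡ 0) (trans (nCn≡1 r) (sym (nCn≡1 (suc r)))))
hockey r g g≡ (suc n) = begin
    (one ⋆ g) (suc n)                           ≡⟨ one-⋆-suc g n ⟩
    g (suc n) + (one ⋆ g) n                     ≡⟨ cong₂ _+_ (g≡ (suc n)) (hockey r g g≡ n) ⟩
    (suc n + r) C r + (n + suc r) C suc r       ≡⟨ cong (λ x → x C r + (n + suc r) C suc r) (sym (+-suc n r)) ⟩
    (n + suc r) C r + (n + suc r) C suc r       ≡⟨ nCk+nC[k+1]≡[n+1]C[k+1] (n + suc r) r ⟩
    (suc n + suc r) C suc r                     ∎

weight : Seq → List ℕ → ℕ
weight w t = product (map w t)

ΣΩ : Seq → ℕ → Seq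
ΣΩ w q m = sum (map (weight w) (Ω q m))

pos : Seq → Seq
pos w zero    = 0
pos w (suc k) = w (suc k)

ΣΩ-zero : ∀ w → ΣΩ w 0 ≗ δ
ΣΩ-zero w zero    = refl
ΣΩ-zero w (suc m) = refl

-- Choosing the first part n₁ = i+1 gives ΣΩ w (q+1) = pos w ⋆ ΣΩ w q,
-- so ΣΩ w q is the q-th convolution power of pos w.
ΣΩ-suc : ∀ w q → ΣΩ w (suc q) ≗ pos w ⋆ ΣΩ w q
ΣΩ-suc w q m = begin
    ΣΩ w (suc q) m
  ≡⟨ sum-concatMap (weight w) (λ i → map (suc i ∷_) (Ω q (m ∸ suc i))) (upTo m) ⟩
    sum (map (λ i → sum (map (weight w) (map (suc i ∷_) (Ω q (m ∸ suc i))))) (upTo m))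
  ≡⟨ sum-applyUpTo m _ (λ i → i) ⟩
    sumTo m (λ i → sum (map (weight w) (map (suc i ∷_) (Ω q (m ∸ suc i)))))
  ≡⟨ sumTo-cong m (λ i _ → first-part (suc i) (Ω q (m ∸ suc i))) ⟩
    sumTo m (λ i → w (suc i) * ΣΩ w q (m ∸ suc i))
  ≡⟨ as-⋆ m ⟩
    (pos w ⋆ ΣΩ w q) m
  ∎
  where
  first-part : ∀ x ts → sum (map (weight w) (map (x ∷_) ts)) ≡ w x * sum (map (weight w) ts)
  first-part x ts = trans (cong sum (sym (map-∘ ts))) (sum-map-* (w x) (weight w) ts)
  as-⋆ : ∀ m → sumTo m (λ i → w (suc i) * ΣΩ w q (m ∸ suc i)) ≡ (pos w ⋆ ΣΩ w q) m
  as-⋆ zero    = refl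
  as-⋆ (suc m) = sym (⋆-as-sum (w ∘ suc) (ΣΩ w q) m)

-- There are no compositions of m into more than m parts.
ΣΩ-vanish : ∀ w q m → m < q → ΣΩ w q m ≡ 0
ΣΩ-vanish w (suc q) m m<q = begin
    ΣΩ w (suc q) m                                 ≡⟨ ΣΩ-suc w q m ⟩
    (pos w ⋆ ΣΩ w q) m                             ≡⟨ ⋆-as-sum (pos w) (ΣΩ w q) m ⟩
    sumTo (suc m) (λ i → pos w i * ΣΩ w q (m ∸ i)) ≡⟨ sumTo-zero (suc m) term-vanishes ⟩
    0                                              ∎
  where
  term-vanishes : ∀ i → i < suc m → pos w i * ΣΩ w q (m ∸ i) ≡ 0
  term-vanishes zero    _           = refl
  term-vanishes (suc j) (s≤s 1+j≤m) = trans (cong (w (suc j) *_) (ΣΩ-vanish w q (m ∸ suc j) m∸1+j<q))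
                                            (*-zeroʳ (w (suc j)))
    where
    m∸1+j<q : m ∸ suc j < q
    m∸1+j<q = ≤-trans (≤-reflexive (sym (+-∸-assoc 1 1+j≤m))) (≤-trans (m∸n≤m m j) (≤-pred m<q))

-- Binomial expansion  binomΩ w s = Σ_{q≤s} C(s,q) ΣΩ w q,  i.e. the
-- coefficients of (1 + pos w)^s.

binomΩ : Seq → ℕ → Seq
binomΩ w s m = sumTo (suc s) (λ q → (s C q) * ΣΩ w q m)

binomΩ-zero : ∀ w → binomΩ w 0 ≗ δ
binomΩ-zero w zero    = refl
binomΩ-zero w (suc m) = refl

binomΩ-suc : ∀ w s → binomΩ w (suc s) ≗ λ m → binomΩ w s m + (pos w ⋆ binomΩ w s) m
binomΩ-suc w s m = begin
    c₀ + sumTo (suc s) (λ q → (suc s C suc q) * ΣΩ w (suc q) m)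
  ≡⟨ cong (λ x → c₀ + x) pascal ⟩
    c₀ + (shifted + same)
  ≡⟨ solve 3 (λ a b c → a :+ (b :+ c) := (a :+ c) :+ b) refl c₀ shifted same ⟩
    (c₀ + same) + shifted
  ≡⟨ cong₂ _+_ binomΩ-again pos-⋆-binomΩ ⟩
    binomΩ w s m + (pos w ⋆ binomΩ w s) m
  ∎
  where
  c₀      = (s C 0) * ΣΩ w 0 m
  shifted = sumTo (suc s) (λ q → (s C q) * ΣΩ w (suc q) m)
  same    = sumTo (suc s) (λ q → (s C suc q) * ΣΩ w (suc q) m)
  pascal : sumTo (suc s) (λ q → (suc s C suc q) * ΣΩ w (suc q) m) ≡ shifted + same
  pascal = trans (sumTo-cong (suc s) λ q _ →
                    trans (cong (_* ΣΩ w (suc q) m) (sym (nCk+nC[k+1]≡[n+1]C[k+1] s q)))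
                          (*-distribʳ-+ (ΣΩ w (suc q) m) (s C q) (s C suc q)))
                 (sumTo-+ (suc s) (λ q → (s C q) * ΣΩ w (suc q) m) (λ q → (s C suc q) * ΣΩ w (suc q) m))
  pos-⋆-binomΩ : shifted ≡ (pos w ⋆ binomΩ w s) m
  pos-⋆-binomΩ = trans (sumTo-cong (suc s) (λ q _ → cong ((s C q) *_) (ΣΩ-suc w q m)))
                       (sym (⋆-sumTo (suc s) (s C_) (pos w) (ΣΩ w) m))
  binomΩ-again : c₀ + same ≡ binomΩ w s m
  binomΩ-again = begin
      c₀ + same                                          ≡⟨ sumTo-snoc (suc s) (λ q → (s C q) * ΣΩ w q m) ⟩
      binomΩ w s m + (s C suc s) * ΣΩ w (suc s) m        ≡⟨ cong (λ x → binomΩ w s m + x * ΣΩ w (suc s) m) (k>n⇒nCk≡0 (n<1+n s)) ⟩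
      binomΩ w s m + 0                                   ≡⟨ +-identityʳ _ ⟩
      binomΩ w s m                                       ∎

-- A weight with constant term 1 is δ + pos w.
split-unit : ∀ w (g : Seq) → w 0 ≡ 1 → w ⋆ g ≗ λ m → g m + (pos w ⋆ g) m
split-unit w g w0≡1 m = begin
    (w ⋆ g) m                         ≡⟨ ⋆-cong w≗δ+pos (λ _ → refl) m ⟩
    ((λ k → 1 * δ k + pos w k) ⋆ g) m  ≡⟨ ⋆-linˡ 1 δ (pos w) g m ⟩
    1 * (δ ⋆ g) m + (pos w ⋆ g) m      ≡⟨ cong (_+ (pos w ⋆ g) m) (trans (*-identityˡ _) (δ-⋆ g m)) ⟩
    g m + (pos w ⋆ g) m                ∎
  where
  w≗δ+pos : ∀ k → w k ≡ 1 * δ k + pos w k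
  w≗δ+pos zero    = w0≡1
  w≗δ+pos (suc k) = refl

binomΩ-power : ∀ w s → w 0 ≡ 1 → binomΩ w (suc s) ≗ w ⋆ binomΩ w s
binomΩ-power w s w0≡1 m = trans (binomΩ-suc w s m) (sym (split-unit w (binomΩ w s) w0≡1 m))

cumΩ : Seq → ℕ → Seq
cumΩ w s = one ⋆ binomΩ w s

-- Since cumΩ w s = one ⋆ w^{⋆s} for w 0 = 1, it satisfies
-- cumΩ w 0 = one and cumΩ w (s+1) = w ⋆ cumΩ w s.
cumΩ-zero : ∀ w → cumΩ w 0 ≗ one
cumΩ-zero w n = trans (⋆-congʳ one (binomΩ-zero w) n) (trans (⋆-comm one δ n) (δ-⋆ one n))

cumΩ-suc : ∀ w s → w 0 ≡ 1 → cumΩ w (suc s) ≗ w ⋆ cumΩ w s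
cumΩ-suc w s w0≡1 n = begin
    (one ⋆ binomΩ w (suc s)) n      ≡⟨ ⋆-congʳ one (binomΩ-power w s w0≡1) n ⟩
    (one ⋆ (w ⋆ binomΩ w s)) n      ≡⟨ sym (⋆-assoc one w (binomΩ w s) n) ⟩
    ((one ⋆ w) ⋆ binomΩ w s) n      ≡⟨ ⋆-cong (⋆-comm one w) (λ _ → refl) n ⟩
    ((w ⋆ one) ⋆ binomΩ w s) n      ≡⟨ ⋆-assoc w one (binomΩ w s) n ⟩
    (w ⋆ (one ⋆ binomΩ w s)) n      ∎

-- Explicitly, the constant term of binomΩ w s being 1,
-- cumΩ w s n = 1 + Σ_{1≤m≤n} binomΩ w s m.
cumΩ-as-sum : ∀ w s n → cumΩ w s n ≡ 1 + sumTo n (binomΩ w s ∘ suc)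
cumΩ-as-sum w s n = trans (one-⋆-as-sum (binomΩ w s) n) (cong (_+ sumTo n (binomΩ w s ∘ suc)) constant-term)
  where
  constant-term : binomΩ w s 0 ≡ 1
  constant-term = cong (λ x → 1 + x) (sumTo-zero s (λ j _ →
    trans (cong ((s C suc j) *_) (ΣΩ-vanish w (suc j) 0 z<s)) (*-zeroʳ (s C suc j))))

-- The weight n ↦ n+1 is one ⋆ one, so its partial sums are C(n+2s, 2s).

one-⋆-one : ∀ k → (one ⋆ one) k ≡ suc k
one-⋆-one k = trans (hockey 0 one (λ _ → refl) k) (trans (cong (_C 1) (+-comm k 1)) (nC1≡n (suc k)))

cumΩ-suc-weight : ∀ s n → cumΩ suc s n ≡ (n + 2 * s) C (2 * s)
cumΩ-suc-weight zero    n = cumΩ-zero suc n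
cumΩ-suc-weight (suc s) n = begin
    cumΩ suc (suc s) n                             ≡⟨ cumΩ-suc suc s refl n ⟩
    (suc ⋆ cumΩ suc s) n                           ≡⟨ ⋆-cong (sym ∘ one-⋆-one) (λ _ → refl) n ⟩
    ((one ⋆ one) ⋆ cumΩ suc s) n                   ≡⟨ ⋆-assoc one one (cumΩ suc s) n ⟩
    (one ⋆ (one ⋆ cumΩ suc s)) n                   ≡⟨ hockey (suc (2 * s)) _ (hockey (2 * s) _ (cumΩ-suc-weight s)) n ⟩
    (n + suc (suc (2 * s))) C suc (suc (2 * s))    ≡⟨ cong (λ x → (n + x) C x) (sym (*-suc 2 s)) ⟩
    (n + 2 * suc s) C (2 * suc s)                  ∎

-- The evenness weight [n even], whose partial sums are C(⌊n/2⌋+s, s).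

evenInd : Seq
evenInd n = suc n % 2

half-suc-suc : ∀ n → suc (suc n) / 2 ≡ suc (n / 2)
half-suc-suc n = m/n≡1+[m∸n]/n {suc (suc n)} {2} (s≤s (s≤s z≤n))

even-hockey : ∀ s (g : Seq) → (∀ k → g k ≡ (k / 2 + s) C s) → ∀ n → (evenInd ⋆ g) n ≡ (n / 2 + suc s) C suc s
even-hockey s g g≡ zero          = trans (+-identityʳ (g 0)) (trans (g≡ 0) (trans (nCn≡1 s) (sym (nCn≡1 (suc s)))))
even-hockey s g g≡ (suc zero)    = trans (+-identityʳ _) (trans (+-identityʳ (g 1)) (trans (g≡ 1) (trans (nCn≡1 s) (sym (nCn≡1 (suc s))))))
even-hockey s g g≡ (suc (suc n)) = begin
    (evenInd ⋆ g) (suc (suc n))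
  ≡⟨ cong₂ _+_ (+-identityʳ (g (suc (suc n)))) (even-hockey s g g≡ n) ⟩
    g (suc (suc n)) + (n / 2 + suc s) C suc s
  ≡⟨ cong (_+ (n / 2 + suc s) C suc s) (trans (g≡ (suc (suc n))) (cong (λ x → (x + s) C s) (half-suc-suc n))) ⟩
    (suc (n / 2) + s) C s + (n / 2 + suc s) C suc s
  ≡⟨ cong (λ x → x C s + (n / 2 + suc s) C suc s) (sym (+-suc (n / 2) s)) ⟩
    (n / 2 + suc s) C s + (n / 2 + suc s) C suc s
  ≡⟨ nCk+nC[k+1]≡[n+1]C[k+1] (n / 2 + suc s) s ⟩
    (suc (n / 2) + suc s) C suc s
  ≡⟨ cong (λ x → (x + suc s) C suc s) (sym (half-suc-suc n)) ⟩
    (suc (suc n) / 2 + suc s) C suc s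
  ∎

cumΩ-even-weight : ∀ s n → cumΩ evenInd s n ≡ (n / 2 + s) C s
cumΩ-even-weight zero    n = cumΩ-zero evenInd n
cumΩ-even-weight (suc s) n = trans (cumΩ-suc evenInd s refl n) (even-hockey s _ (cumΩ-even-weight s) n)

-- The primed half-integer binomial coefficient C(m/2, q)' is the
-- coefficient (evenInd ⋆ ΣΩ evenInd q) m of x^m in (1-x²)^{-(q+1)}.

half-binomial-if : ∀ (b : Bool) m q →
  (if b then (m / 2) C q else 0) + (if b then (m / 2) C suc q else 0) ≡ (if b then (suc (suc m) / 2) C suc q else 0)
half-binomial-if true  m q = trans (nCk+nC[k+1]≡[n+1]C[k+1] (m / 2) q) (cong (_C suc q) (sym (half-suc-suc m)))
half-binomial-if false m q = refl

evenInd-as-binomial : ∀ m → evenInd m ≡ binom′½ (+ m) (+ 0)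
evenInd-as-binomial zero          = refl
evenInd-as-binomial (suc zero)    = refl
evenInd-as-binomial (suc (suc m)) = evenInd-as-binomial m

half-binomial : ∀ q m → (evenInd ⋆ ΣΩ evenInd q) m ≡ binom′½ (+ m) (+ q)
half-binomial zero m = begin
    (evenInd ⋆ ΣΩ evenInd 0) m    ≡⟨ ⋆-congʳ evenInd (ΣΩ-zero evenInd) m ⟩
    (evenInd ⋆ δ) m               ≡⟨ ⋆-comm evenInd δ m ⟩
    (δ ⋆ evenInd) m               ≡⟨ δ-⋆ evenInd m ⟩
    evenInd m                     ≡⟨ evenInd-as-binomial m ⟩
    binom′½ (+ m) (+ 0)           ∎
half-binomial (suc q) = pascal-step
  where
  pascal-step : ∀ m → (evenInd ⋆ ΣΩ evenInd (suc q)) m ≡ binom′½ (+ m) (+ suc q)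
  pascal-step zero          = trans (+-identityʳ _) (ΣΩ-suc evenInd q 0)
  pascal-step (suc zero)    = trans (+-identityʳ _) (trans (+-identityʳ _) (ΣΩ-suc evenInd q 1))
  pascal-step (suc (suc m)) =
    trans (cong₂ _+_ (trans (+-identityʳ _) (trans (ΣΩ-suc evenInd q (suc (suc m))) (half-binomial q m)))
                     (pascal-step m))
          (half-binomial-if (m % 2 ≡ᵇ 0) m q)

binom′½-as-ΣΩ : ∀ i j → binom′½ (+ suc i -ℤ + 2) (+ suc j -ℤ + 1) ≡ ΣΩ evenInd (suc j) (suc i)
binom′½-as-ΣΩ zero    j = sym (ΣΩ-suc evenInd j 1)
binom′½-as-ΣΩ (suc i) j = sym (trans (ΣΩ-suc evenInd j (suc (suc i))) (half-binomial j i))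

-- Parity: (n₁+1)⋯(n_q+1) ≡ [n₁ even]⋯[n_q even] (mod 2), which splits the
-- floor term:  ΣΩ suc q m = ΣΩ evenInd q m + 2 · floorΩ q m.

parity-* : ∀ n p → (suc n * p) % 2 ≡ evenInd n * (p % 2)
parity-* zero          p = trans (cong (_% 2) (*-identityˡ p)) (sym (*-identityˡ (p % 2)))
parity-* (suc zero)    p = trans (cong (_% 2) (*-comm 2 p)) ([m+kn]%n≡m%n 0 p 2)
parity-* (suc (suc n)) p = begin
    (3 + n) * p % 2               ≡⟨ cong (_% 2) (solve 2 (λ n p → (con 3 :+ n) :* p := (con 1 :+ n) :* p :+ p :* con 2) refl n p) ⟩
    ((1 + n) * p + p * 2) % 2     ≡⟨ [m+kn]%n≡m%n (suc n * p) p 2 ⟩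
    (1 + n) * p % 2               ≡⟨ parity-* n p ⟩
    evenInd n * (p % 2)           ∎

parity-weight : ∀ t → weight suc t % 2 ≡ weight evenInd t
parity-weight []      = refl
parity-weight (n ∷ t) = trans (parity-* n (weight suc t)) (cong (evenInd n *_) (parity-weight t))

floorΩ : ℕ → Seq
floorΩ q m = sum (map (λ t → product (map suc t) / 2) (Ω q m))

ΣΩ-parity-split : ∀ q m → ΣΩ suc q m ≡ ΣΩ evenInd q m + 2 * floorΩ q m
ΣΩ-parity-split q m = begin
    sum (map (weight suc) ts)                                      ≡⟨ cong sum (map-cong floor-split ts) ⟩
    sum (map (λ t → weight evenInd t + 2 * (weight suc t / 2)) ts) ≡⟨ sum-map-+ (weight evenInd) _ ts ⟩
    ΣΩ evenInd q m + sum (map (λ t → 2 * (weight suc t / 2)) ts)  ≡⟨ cong (λ x → ΣΩ evenInd q m + x) (sum-map-* 2 _ ts) ⟩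
    ΣΩ evenInd q m + 2 * floorΩ q m                                ∎
  where
  ts = Ω q m
  floor-split : ∀ t → weight suc t ≡ weight evenInd t + 2 * (weight suc t / 2)
  floor-split t = trans (m≡m%n+[m/n]*n (weight suc t) 2)
                        (cong₂ _+_ (parity-weight t) (*-comm (weight suc t / 2) 2))

row : ℕ → Seq
row s m = sumTo (m ⊓ s) (λ j → (s C suc j) * (binom′½ (+ m -ℤ + 2) (+ suc j -ℤ + 1) + floorΩ (suc j) m))

N-as-rows : ∀ n s → N n s ≡ sumTo n (row s ∘ suc)
N-as-rows n s = trans (Σ-from-1 n (λ m → Σ[ 1 ⋯ m ⊓ s ] (term m))) (sumTo-cong n (λ i _ → Σ-from-1 (suc i ⊓ s) (term (suc i))))
  where
  term : ℕ → Seq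
  term m q = (s C q) * (binom′½ (+ m -ℤ + 2) (+ q -ℤ + 1) + floorΩ q m)

-- Doubling a row gives the q ≥ 1 part of both binomial sums; at m ≥ 1 the
-- q = 0 terms vanish, and so do the terms with q > m.
two-rows : ∀ s i → 2 * row s (suc i) ≡ binomΩ suc s (suc i) + binomΩ evenInd s (suc i)
two-rows s i = begin
    2 * row s (suc i)
  ≡⟨ sym (sumTo-* (suc i ⊓ s) 2 _) ⟩
    sumTo (suc i ⊓ s) (λ j → 2 * ((s C suc j) * (binom′½ (+ suc i -ℤ + 2) (+ suc j -ℤ + 1) + floorΩ (suc j) (suc i))))
  ≡⟨ sumTo-cong (suc i ⊓ s) (λ j _ → doubled-term j) ⟩
    sumTo (suc i ⊓ s) term
  ≡⟨ sumTo-⊓ (suc i) s term term-vanishes ⟩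
    sumTo s term
  ≡⟨ sumTo-+ s (λ j → (s C suc j) * ΣΩ suc (suc j) (suc i)) (λ j → (s C suc j) * ΣΩ evenInd (suc j) (suc i)) ⟩
    binomΩ suc s (suc i) + binomΩ evenInd s (suc i)
  ∎
  where
  term : Seq
  term j = (s C suc j) * ΣΩ suc (suc j) (suc i) + (s C suc j) * ΣΩ evenInd (suc j) (suc i)
  doubled-term : ∀ j → 2 * ((s C suc j) * (binom′½ (+ suc i -ℤ + 2) (+ suc j -ℤ + 1) + floorΩ (suc j) (suc i))) ≡ term j
  doubled-term j rewrite binom′½-as-ΣΩ i j | ΣΩ-parity-split (suc j) (suc i) =
    solve 3 (λ c e h → con 2 :* (c :* (e :+ h)) := c :* (e :+ con 2 :* h) :+ c :* e) refl
      (s C suc j) (ΣΩ evenInd (suc j) (suc i)) (floorΩ (suc j) (suc i))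
  term-vanishes : ∀ j → suc i ≤ j → term j ≡ 0
  term-vanishes j i<j rewrite ΣΩ-vanish suc (suc j) (suc i) (s≤s i<j)
                            | ΣΩ-vanish evenInd (suc j) (suc i) (s≤s i<j)
                            | *-zeroʳ (s C suc j) = refl

twice-N : ∀ n s → 2 * N n s + 2 ≡ (n + 2 * s) C (2 * s) + (n / 2 + s) C s
twice-N n s = begin
    2 * N n s + 2
  ≡⟨ cong (λ x → 2 * x + 2) (N-as-rows n s) ⟩
    2 * sumTo n (row s ∘ suc) + 2
  ≡⟨ cong (_+ 2) (trans (sym (sumTo-* n 2 _)) (trans (sumTo-cong n (λ i _ → two-rows s i)) (sumTo-+ n _ _))) ⟩
    Σsuc + Σeven + 2
  ≡⟨ solve 2 (λ a b → a :+ b :+ con 2 := (con 1 :+ a) :+ (con 1 :+ b)) refl Σsuc Σeven ⟩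
    (1 + Σsuc) + (1 + Σeven)
  ≡⟨ cong₂ _+_ (trans (sym (cumΩ-as-sum suc s n)) (cumΩ-suc-weight s n))
               (trans (sym (cumΩ-as-sum evenInd s n)) (cumΩ-even-weight s n)) ⟩
    (n + 2 * s) C (2 * s) + (n / 2 + s) C s
  ∎
  where
  Σsuc  = sumTo n (binomΩ suc s ∘ suc)
  Σeven = sumTo n (binomΩ evenInd s ∘ suc)

theorem1 : (n s : ℕ) → NonZero n → NonZero s →
    (+ N n s) ℚ./ 1 ≡ T n (2 * s) ℚ.+ T (n / 2) s
theorem1 n s _ _ = halve (N n s) ((n + 2 * s) C (2 * s)) ((n / 2 + s) C s) (twice-N n s)
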